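{- Let $\Gamma$ be a finite, simple, connected, undirected tree with adjacency matrix $A(\Gamma)$, and let $n$ be a nonnegative integer. The following are equivalent: (1) the length of the longest path of $\Gamma$ is $n$; (2) $\beta(A(\Gamma)^{n+1})=\beta(A(\Gamma)^{n-1})$, and $n$ is the minimum number with this property. Equivalently, the length of the longest path of $\Gamma$ equals $\mathfrak{D}(\Gamma)=\min\{n \mid \beta(A(\Gamma)^{n+1})=\beta(A(\Gamma)^{n-1})\}$.
   Context: For a square matrix $Q$, $\beta(Q)$ is the $(0,1)$-matrix with $\beta(Q)_{i,j}=1$ if $Q_{i,j}\ne 0$ and $0$ otherwise. $A(\Gamma)_{i,j}=1$ iff $\{v_i,v_j\}$ is an edge, else $0$; $A(\Gamma)^0$ is the identity matrix. A path is a sequence of distinct vertices in which consecutive vertices are adjacent; its length is its number of edges. -}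

module Defs where

open import Data.Nat using (ℕ; zero; suc; _+_; _*_; _≡ᵇ_)
open import Data.Bool using (Bool; true; false; not; if_then_else_)
open import Data.Fin using (Fin; zero; suc; _≟_)
open import Data.List using (List; []; _∷_; length)
open import Data.List.Relation.Unary.Linked using (Linked)
open import Data.List.Relation.Unary.Unique.Propositional using (Unique)
open import Data.Product using (_×_; Σ; ∃)
open import Relation.Binary.PropositionalEquality using (_≡_)
open import Relation.Nullary using (¬_)
open import Relation.Nullary.Decidable using (⌊_⌋)

Graph : ℕ → Set
Graph m = Fin m → Fin m → Bool

Adj : ∀ {m} → Graph m → Fin m → Fin m → Set
Adj E u v = E u v ≡ true

IsSimple : ∀ {m} → Graph m → Set
IsSimple E = (∀ u v → E u v ≡ E v u) × (∀ u → E u u ≡ false)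

-- a walk/path is encoded as a nonempty list of vertices  x ∷ xs
endpoint : ∀ {m} → Fin m → List (Fin m) → Fin m
endpoint x [] = x
endpoint x (y ∷ ys) = endpoint y ys

-- the vertex sequence x ∷ xs is a path: distinct vertices, consecutive ones adjacent.
-- Its length (number of edges) is  length xs.
IsPath : ∀ {m} → Graph m → Fin m → List (Fin m) → Set
IsPath E x xs = Linked (Adj E) (x ∷ xs) × Unique (x ∷ xs)

Connected : ∀ {m} → Graph m → Set
Connected {m} E = ∀ (u v : Fin m) → Σ (List (Fin m)) λ xs → IsPath E u xs × endpoint u xs ≡ v

HasCycle : ∀ {m} → Graph m → Set
HasCycle {m} E = Σ (Fin m) λ x → Σ (List (Fin m)) λ xs →
  IsPath E x xs × (2 Data.Nat.≤ length xs) × Adj E (endpoint x xs) x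

IsTree : ∀ {m} → Graph m → Set
IsTree E = Connected E × ¬ HasCycle E

LongestPathLength : ∀ {m} → Graph m → ℕ → Set
LongestPathLength {m} E n =
  (Σ (Fin m) λ x → Σ (List (Fin m)) λ xs → IsPath E x xs × length xs ≡ n)
  × (∀ (x : Fin m) (xs : List (Fin m)) → IsPath E x xs → length xs Data.Nat.≤ n)

Matrix : ℕ → Set
Matrix m = Fin m → Fin m → ℕ

∑ : ∀ {m} → (Fin m → ℕ) → ℕ
∑ {zero} f = 0
∑ {suc m} f = f zero + ∑ {m} (λ i → f (suc i))

_⊗_ : ∀ {m} → Matrix m → Matrix m → Matrix m
(P ⊗ Q) i j = ∑ (λ k → P i k * Q k j)

I : ∀ {m} → Matrix m
I i j = if ⌊ i ≟ j ⌋ then 1 else 0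

_^^_ : ∀ {m} → Matrix m → ℕ → Matrix m
Q ^^ zero = I
Q ^^ suc k = Q ⊗ (Q ^^ k)

adjMatrix : ∀ {m} → Graph m → Matrix m
adjMatrix E i j = if E i j then 1 else 0

β : ∀ {m} → Matrix m → Fin m → Fin m → Bool
β Q i j = not (Q i j ≡ᵇ 0)

SamePattern : ∀ {m} → Matrix m → Matrix m → Set
SamePattern {m} P Q = ∀ (i j : Fin m) → β P i j ≡ β Q i j

-- Nonzero entries of A^k record the walks of length k.  A walk that
-- backtracks (… u v u …) shortens by two, and in a tree a walk that never
-- backtracks is a path; moreover a non-backtracking walk is a shortest walk
-- between its ends.  So for k ≥ 1, β(A^(k+1)) = β(A^(k-1)) says exactly that every
-- walk of length k+1 backtracks, i.e. that no path has length k+1, and the least such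
-- k is the length of a longest path.
module Submission where

open import Defs
open import Data.Nat using (ℕ; zero; suc; _+_; _*_; _∸_; _≤_; _<_; _≡ᵇ_; z≤n; s≤s; _≤?_)
open import Data.Nat.Properties
  using (≤-trans; ≤-reflexive; +-comm; +-suc; +-identityʳ; +-monoʳ-≤; n≤1+n; m≤m+n; m≤n+m;
         ≰⇒>; 1+n≰n; *-zeroʳ; m∸n≤m; suc-injective; m≤n⇒m⊓n≡m)
open import Data.Bool using (Bool; true; false; not)
open import Data.Bool.Properties using (⇔→≡) renaming (_≟_ to _≟ᵇ_)
open import Data.Fin using (Fin; zero; suc; _≟_; punchIn)
open import Data.Fin.Properties using (all?; ¬∀⟶∃¬; punchInᵢ≢i)
open import Data.List using (List; []; _∷_; length; _++_; take)
open import Data.List.Properties using (length-take)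
open import Data.List.Relation.Unary.Linked as Linked using (Linked; []; [-]; _∷_)
open import Data.List.Relation.Unary.All as All using (All; []; _∷_)
open import Data.List.Relation.Unary.All.Properties using (¬Any⇒All¬; ++⁻)
open import Data.List.Relation.Unary.AllPairs using ([]; _∷_)
open import Data.List.Relation.Unary.Any using (here; there)
open import Data.List.Membership.Propositional using (_∈_)
open import Data.List.Membership.Propositional.Properties using (∈-∃++)
open import Data.List.Relation.Unary.Unique.Propositional using (Unique)
import Data.List.Relation.Unary.Unique.Propositional.Properties as Unique
open import Data.Product using (_×_; Σ; ∃; ∃₂; _,_; proj₁; proj₂)
open import Data.Sum using (_⊎_; inj₁; inj₂)
open import Data.Unit using (⊤; tt)
open import Data.Empty using (⊥; ⊥-elim)
open import Relation.Nullary using (¬_; yes; no; Dec)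
open import Relation.Binary.PropositionalEquality
open import Function.Bundles using (_⇔_; mk⇔)

∑-pos : ∀ {m} (f : Fin m → ℕ) (l : Fin m) → 0 < f l → 0 < ∑ f
∑-pos f zero    p = ≤-trans p (m≤m+n (f zero) _)
∑-pos f (suc l) p = ≤-trans (∑-pos (λ i → f (suc i)) l p) (m≤n+m _ (f zero))

∑-pos⁻ : ∀ {m} (f : Fin m → ℕ) → 0 < ∑ f → ∃ λ l → 0 < f l
∑-pos⁻ {suc m} f p with f zero in eq
... | suc _ = zero , subst (0 <_) (sym eq) (s≤s z≤n)
... | zero  = let (l , q) = ∑-pos⁻ (λ i → f (suc i)) p in suc l , q

*-pos : ∀ {a b} → 0 < a → 0 < b → 0 < a * b
*-pos {suc a} {suc b} _ _ = s≤s z≤n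

*-pos⁻ : ∀ a b → 0 < a * b → 0 < a × 0 < b
*-pos⁻ (suc a) zero    p with subst (0 <_) (*-zeroʳ (suc a)) p
... | ()
*-pos⁻ (suc a) (suc b) _ = s≤s z≤n , s≤s z≤n

β≡true⇒pos : ∀ n → not (n ≡ᵇ 0) ≡ true → 0 < n
β≡true⇒pos (suc n) _ = s≤s z≤n

pos⇒β≡true : ∀ n → 0 < n → not (n ≡ᵇ 0) ≡ true
pos⇒β≡true (suc n) _ = refl

samePattern-or-mismatch : ∀ {m} (P Q : Matrix m) →
  SamePattern P Q ⊎ ∃₂ λ i j → β P i j ≢ β Q i j
samePattern-or-mismatch {m} P Q = decide (all? row?)
  where
  row? : ∀ i → Dec (∀ j → β P i j ≡ β Q i j)
  row? i = all? λ j → β P i j ≟ᵇ β Q i j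

  decide : Dec (SamePattern P Q) → SamePattern P Q ⊎ ∃₂ λ i j → β P i j ≢ β Q i j
  decide (yes same) = inj₁ same
  decide (no differ) with ¬∀⟶∃¬ m _ row? differ
  ... | i , ¬row with ¬∀⟶∃¬ m _ (λ j → β P i j ≟ᵇ β Q i j) ¬row
  ... | j , ne = inj₂ (i , j , ne)

mismatch⇒true : ∀ {a b : Bool} → a ≢ b → (b ≡ true → a ≡ true) → a ≡ true × b ≢ true
mismatch⇒true {true}          ne _ = refl , λ b≡true → ne (sym b≡true)
mismatch⇒true {false} {true}  ne b⇒a with b⇒a refl
... | ()
mismatch⇒true {false} {false} ne _ = ⊥-elim (ne refl)

module _ {A : Set} where

  NonBacktracking : List A → Set
  NonBacktracking (x ∷ y ∷ z ∷ zs) = x ≢ z × NonBacktracking (y ∷ z ∷ zs)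
  NonBacktracking _                = ⊤

  nonBacktracking-tail : ∀ x xs → NonBacktracking (x ∷ xs) → NonBacktracking xs
  nonBacktracking-tail x []           _        = tt
  nonBacktracking-tail x (y ∷ [])     _        = tt
  nonBacktracking-tail x (y ∷ z ∷ zs) (_ , nb) = nb

  unique⇒nonBacktracking : ∀ xs → Unique xs → NonBacktracking xs
  unique⇒nonBacktracking []                _                    = tt
  unique⇒nonBacktracking (x ∷ [])          _                    = tt
  unique⇒nonBacktracking (x ∷ y ∷ [])      _                    = tt
  unique⇒nonBacktracking (x ∷ y ∷ z ∷ zs) ((_ ∷ x≢z ∷ _) ∷ u) = x≢z , unique⇒nonBacktracking (y ∷ z ∷ zs) u

  Unique-++⁻ : ∀ pre {x : A} {post} → Unique (pre ++ x ∷ post) → Unique (x ∷ pre)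
  Unique-++⁻ []        _       = [] ∷ []
  Unique-++⁻ (y ∷ pre) (h ∷ u) with Unique-++⁻ pre u | ++⁻ pre h
  ... | x∉pre ∷ upre | y∉pre , y≢x ∷ _ = ((λ x≡y → y≢x (sym x≡y)) ∷ x∉pre) ∷ y∉pre ∷ upre

  Linked-take : ∀ {R : A → A → Set} x xs k → Linked R (x ∷ xs) → Linked R (x ∷ take k xs)
  Linked-take x xs       zero    _       = [-]
  Linked-take x []       (suc k) _       = [-]
  Linked-take x (y ∷ ys) (suc k) (r ∷ l) = r ∷ Linked-take y ys k l

length-take-≤ : ∀ {a} {A : Set a} k (xs : List A) → k ≤ length xs → length (take k xs) ≡ k
length-take-≤ k xs k≤ = trans (length-take k xs) (m≤n⇒m⊓n≡m k≤)

Linked-++⁻ : ∀ {m} {R : Fin m → Fin m → Set} x pre {y post} →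
  Linked R (x ∷ pre ++ y ∷ post) → Linked R (x ∷ pre) × R (endpoint x pre) y
Linked-++⁻ x []        (r ∷ _) = [-] , r
Linked-++⁻ x (p ∷ pre) (r ∷ l) with Linked-++⁻ p pre l
... | l′ , r′ = r ∷ l′ , r′

endpoint-∈ : ∀ {m} (x : Fin m) xs → endpoint x xs ∈ x ∷ xs
endpoint-∈ x []       = here refl
endpoint-∈ x (y ∷ ys) = there (endpoint-∈ y ys)

module Walks {m : ℕ} (E : Graph m) where

  A : Matrix m
  A = adjMatrix E

  Walk : ℕ → Fin m → Fin m → Set
  Walk k i j = Σ (List (Fin m)) λ ws → Linked (Adj E) (i ∷ ws) × length ws ≡ k × endpoint i ws ≡ j

  IsReducedWalk : Fin m → List (Fin m) → Set
  IsReducedWalk x xs = Linked (Adj E) (x ∷ xs) × NonBacktracking (x ∷ xs)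

  HasPathOfLength : ℕ → Set
  HasPathOfLength n = Σ (Fin m) λ x → Σ (List (Fin m)) λ xs → IsPath E x xs × length xs ≡ n

  PathsBoundedBy : ℕ → Set
  PathsBoundedBy n = ∀ (x : Fin m) (xs : List (Fin m)) → IsPath E x xs → length xs ≤ n

  PatternStableAt : ℕ → Set
  PatternStableAt k = SamePattern (A ^^ (k + 1)) (A ^^ (k ∸ 1))

  walk-resize : ∀ {k l i j} → k ≡ l → Walk k i j → Walk l i j
  walk-resize {i = i} {j} = subst (λ t → Walk t i j)

  adj-pos : ∀ i l → Adj E i l → 0 < A i l
  adj-pos i l a rewrite a = s≤s z≤n

  adj-pos⁻ : ∀ i l → 0 < A i l → Adj E i l
  adj-pos⁻ i l p with E i l
  ... | true = refl

  I-pos : ∀ (i : Fin m) → 0 < I i i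
  I-pos i with i ≟ i
  ... | yes _   = s≤s z≤n
  ... | no i≢i = ⊥-elim (i≢i refl)

  I-pos⁻ : ∀ (i j : Fin m) → 0 < I i j → i ≡ j
  I-pos⁻ i j p with i ≟ j
  ... | yes i≡j = i≡j

  power-pos⇒walk : ∀ k i j → 0 < (A ^^ k) i j → Walk k i j
  power-pos⇒walk zero    i j p = [] , [-] , refl , I-pos⁻ i j p
  power-pos⇒walk (suc k) i j p with ∑-pos⁻ (λ l → A i l * (A ^^ k) l j) p
  ... | l , q with *-pos⁻ (A i l) ((A ^^ k) l j) q
  ... | p₁ , p₂ with power-pos⇒walk k l j p₂
  ... | ws , lw , len , ep = l ∷ ws , adj-pos⁻ i l p₁ ∷ lw , cong suc len , ep

  walk⇒power-pos : ∀ k i j → Walk k i j → 0 < (A ^^ k) i j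
  walk⇒power-pos zero    i .i ([] , _ , _ , refl) = I-pos i
  walk⇒power-pos (suc k) i j  (l ∷ ws , a ∷ lw , len , ep) =
    ∑-pos (λ l → A i l * (A ^^ k) l j) l
      (*-pos (adj-pos i l a) (walk⇒power-pos k l j (ws , lw , suc-injective len , ep)))

  pattern⇒walk : ∀ k i j → β (A ^^ k) i j ≡ true → Walk k i j
  pattern⇒walk k i j h = power-pos⇒walk k i j (β≡true⇒pos _ h)

  walk⇒pattern : ∀ k i j → Walk k i j → β (A ^^ k) i j ≡ true
  walk⇒pattern k i j w = pos⇒β≡true _ (walk⇒power-pos k i j w)

  patternStable⇒shortcut : ∀ k → PatternStableAt k → ∀ i j → Walk (suc k) i j → Walk (k ∸ 1) i j
  patternStable⇒shortcut k stable i j w = pattern⇒walk (k ∸ 1) i j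
    (trans (sym (stable i j)) (walk⇒pattern (k + 1) i j (walk-resize (+-comm 1 k) w)))

  reducedWalk-or-shortcut : ∀ k x ws {j} → Linked (Adj E) (x ∷ ws) → length ws ≡ 2 + k → endpoint x ws ≡ j →
    NonBacktracking (x ∷ ws) ⊎ Walk k x j
  reducedWalk-or-shortcut k x (y ∷ z ∷ zs) (a ∷ l) len ep with x ≟ z
  ... | yes refl = inj₂ (zs , Linked.tail l , suc-injective (suc-injective len) , ep)
  reducedWalk-or-shortcut zero    x (y ∷ z ∷ []) _ _ _ | no x≢z = inj₁ (x≢z , tt)
  reducedWalk-or-shortcut (suc k) x (y ∷ z ∷ zs) (a ∷ l) len ep | no x≢z
    with reducedWalk-or-shortcut k y (z ∷ zs) l (suc-injective len) ep
  ... | inj₁ nb                   = inj₁ (x≢z , nb)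
  ... | inj₂ (ys , ly , len′ , ep′) = inj₂ (y ∷ ys , a ∷ ly , cong suc len′ , ep′)

module Symmetric {m : ℕ} {E : Graph m} (symmetric : ∀ u v → E u v ≡ E v u) where
  open Walks E

  adj-sym : ∀ {u v} → Adj E u v → Adj E v u
  adj-sym {u} {v} a = trans (symmetric v u) a

  walk-extend : (∀ i → ∃ (Adj E i)) → ∀ {k i j} → Walk k i j → Walk (2 + k) i j
  walk-extend neighbour {i = i} (ws , lw , len , ep) with neighbour i
  ... | u , a = u ∷ i ∷ ws , a ∷ adj-sym a ∷ lw , cong (2 +_) len , ep

  -- Slide the start of the reduced walk t ∷ r along t ∷ ws, one step at a time: the
  -- reversed step is either prepended or cancelled against the first step of r.
  reroot : ∀ t ws r → Linked (Adj E) (t ∷ ws) → IsReducedWalk t r →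
    Σ (List (Fin m)) λ r′ → IsReducedWalk (endpoint t ws) r′ × endpoint (endpoint t ws) r′ ≡ endpoint t r
      × length r ≤ length r′ + length ws
  reroot t [] r _ red = r , red , refl , ≤-reflexive (sym (+-identityʳ _))
  reroot t (w ∷ ws) [] (a ∷ lw) _ with reroot w ws (t ∷ []) lw (adj-sym a ∷ [-] , tt)
  ... | r′ , red′ , ep , _ = r′ , red′ , ep , z≤n
  reroot t (w ∷ ws) (s ∷ r) (a ∷ lw) (lr , nr) with w ≟ s
  reroot t (w ∷ ws) (.w ∷ r) (a ∷ lw) (_ ∷ lr , nr) | yes refl
    with reroot w ws r lw (lr , nonBacktracking-tail t (w ∷ r) nr)
  ... | r′ , red′ , ep , len = r′ , red′ , ep , ≤-trans (s≤s len) (≤-reflexive (sym (+-suc (length r′) (length ws))))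
  reroot t (w ∷ ws) (s ∷ r) (a ∷ lw) (lr , nr) | no w≢s
    with reroot w ws (t ∷ s ∷ r) lw (adj-sym a ∷ lr , w≢s , nr)
  ... | r′ , red′ , ep , len = r′ , red′ , ep , ≤-trans (n≤1+n _) (≤-trans len (+-monoʳ-≤ (length r′) (n≤1+n _)))

module Forest {m : ℕ} {E : Graph m} (symmetric : ∀ u v → E u v ≡ E v u) (loopless : ∀ u → E u u ≡ false)
              (acyclic : ¬ HasCycle E) where
  open Walks E
  open Symmetric symmetric

  ¬adj-refl : ∀ {u} → ¬ Adj E u u
  ¬adj-refl {u} a with trans (sym (loopless u)) a
  ... | ()

  adj⇒≢ : ∀ {u v} → Adj E u v → u ≢ v
  adj⇒≢ a refl = ¬adj-refl a

  reducedWalk-never-returns : ∀ x pre post → IsReducedWalk x (pre ++ x ∷ post) → Unique (pre ++ x ∷ post) → ⊥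
  reducedWalk-never-returns x []            post (a ∷ _ , _)     _ = ¬adj-refl a
  reducedWalk-never-returns x (p ∷ [])      post (_ , x≢x , _) _ = x≢x refl
  reducedWalk-never-returns x (p ∷ q ∷ pre) post (l , _)         u with Linked-++⁻ x (p ∷ q ∷ pre) l
  ... | l′ , a = acyclic (x , p ∷ q ∷ pre , (l′ , Unique-++⁻ (p ∷ q ∷ pre) u) , s≤s (s≤s z≤n) , a)

  reducedWalk⇒path : ∀ x xs → IsReducedWalk x xs → IsPath E x xs
  reducedWalk⇒path x []       _             = [-] , [] ∷ []
  reducedWalk⇒path x (y ∷ ys) (a ∷ l , nb) with reducedWalk⇒path y ys (l , nonBacktracking-tail x (y ∷ ys) nb)
  ... | _ , uy = a ∷ l , ¬Any⇒All¬ (y ∷ ys) x∉ ∷ uy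
    where
    x∉ : ¬ x ∈ y ∷ ys
    x∉ x∈ with ∈-∃++ x∈
    ... | pre , post , eq =
      reducedWalk-never-returns x pre post (subst (IsReducedWalk x) eq (a ∷ l , nb)) (subst Unique eq uy)

  closed-reducedWalk⇒[] : ∀ z r → IsReducedWalk z r → endpoint z r ≡ z → r ≡ []
  closed-reducedWalk⇒[] z []      _   _ = refl
  closed-reducedWalk⇒[] z (c ∷ r) red e with reducedWalk⇒path z (c ∷ r) red
  ... | _ , (z∉ ∷ _) = ⊥-elim (All.lookup z∉ (endpoint-∈ c r) (sym e))

  reducedWalk-shortest : ∀ {k} x ps → IsReducedWalk x ps → Walk k x (endpoint x ps) → length ps ≤ k
  reducedWalk-shortest x ps red (ws , lw , refl , ep) with reroot x ws ps lw red
  ... | r′ , red′ , ep′ , len with closed-reducedWalk⇒[] _ r′ red′ (trans ep′ (sym ep))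
  ... | refl = len

  pattern-path-or-shortcut : ∀ k i j → β (A ^^ (suc k + 1)) i j ≡ true →
    HasPathOfLength (2 + k) ⊎ β (A ^^ k) i j ≡ true
  pattern-path-or-shortcut k i j h with pattern⇒walk (suc k + 1) i j h
  ... | ws , lw , len , ep with reducedWalk-or-shortcut k i ws lw (trans len (+-comm (suc k) 1)) ep
  ...   | inj₁ nb = inj₁ (i , ws , reducedWalk⇒path i ws (lw , nb) , trans len (+-comm (suc k) 1))
  ...   | inj₂ w  = inj₂ (walk⇒pattern k i j w)

  patternStable⇒pathsBounded : ∀ k → PatternStableAt k → PathsBoundedBy k
  patternStable⇒pathsBounded k stable x xs (lx , ux) with length xs ≤? k
  ... | yes ≤k = ≤k
  ... | no ≰k  = ⊥-elim (1+n≰n (≤-trans (≤-reflexive (sym len)) (≤-trans shortest (m∸n≤m k 1))))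
    where
    prefix : List (Fin m)
    prefix = take (suc k) xs
    len : length prefix ≡ suc k
    len = length-take-≤ (suc k) xs (≰⇒> ≰k)
    linked : Linked (Adj E) (x ∷ prefix)
    linked = Linked-take x xs (suc k) lx
    shortest : length prefix ≤ k ∸ 1
    shortest = reducedWalk-shortest x prefix
      (linked , unique⇒nonBacktracking (x ∷ prefix) (Unique.take⁺ (suc (suc k)) ux))
      (patternStable⇒shortcut k stable x _ (prefix , linked , len , refl))

  module WithoutIsolatedVertices (neighbour : ∀ i → ∃ (Adj E i)) where

    neighbour-path : ∀ i → IsPath E i (proj₁ (neighbour i) ∷ [])
    neighbour-path i = proj₂ (neighbour i) ∷ [-] , (adj⇒≢ (proj₂ (neighbour i)) ∷ []) ∷ [] ∷ []

    pattern-step : ∀ k i j → β (A ^^ k) i j ≡ true → β (A ^^ (suc k + 1)) i j ≡ true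
    pattern-step k i j h =
      walk⇒pattern (suc k + 1) i j (walk-resize (sym (+-comm (suc k) 1)) (walk-extend neighbour (pattern⇒walk k i j h)))

    pathsBounded⇒patternStable : ∀ k → PathsBoundedBy k → PatternStableAt k
    -- The edge at i forces 1 ≤ k, so that k ∸ 1 is really k - 1.
    pathsBounded⇒patternStable k bounded i j with bounded i _ (neighbour-path i)
    pathsBounded⇒patternStable (suc k) bounded i j | s≤s _ = ⇔→≡ (mk⇔ shorten (pattern-step k i j))
      where
      shorten : β (A ^^ (suc k + 1)) i j ≡ true → β (A ^^ k) i j ≡ true
      shorten h with pattern-path-or-shortcut k i j h
      ... | inj₁ (_ , xs , path , len) = ⊥-elim (1+n≰n (subst (_≤ suc k) len (bounded _ xs path)))
      ... | inj₂ short                 = short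

    patternStable-or-longPath : ∀ k → PatternStableAt k ⊎ HasPathOfLength (suc k)
    patternStable-or-longPath k with samePattern-or-mismatch (A ^^ (k + 1)) (A ^^ (k ∸ 1))
    ... | inj₁ stable = inj₁ stable
    patternStable-or-longPath zero    | inj₂ (i , _ , _)  = inj₂ (i , _ , neighbour-path i , refl)
    patternStable-or-longPath (suc k) | inj₂ (i , j , ne) with mismatch⇒true ne (pattern-step k i j)
    ... | long , ¬short with pattern-path-or-shortcut k i j long
    ...   | inj₁ path  = inj₂ path
    ...   | inj₂ short = ⊥-elim (¬short short)

connected⇒neighbour : ∀ {m} {E : Graph (suc (suc m))} → Connected E → ∀ i → ∃ (Adj E i)
connected⇒neighbour connected i with connected i (punchIn i zero)
... | []    , _             , i≡j = ⊥-elim (punchInᵢ≢i i zero (sym i≡j))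
... | y ∷ _ , (a ∷ _ , _) , _   = y , a

theorem1 : ∀ (m : ℕ) (E : Graph m) → IsSimple E → IsTree E → 2 ≤ m → ∀ (n : ℕ) →
    LongestPathLength E n
      ⇔ (SamePattern (adjMatrix E ^^ (n + 1)) (adjMatrix E ^^ (n ∸ 1))
          × (∀ (k : ℕ) → SamePattern (adjMatrix E ^^ (k + 1)) (adjMatrix E ^^ (k ∸ 1)) → n ≤ k))
theorem1 m E (symmetric , loopless) (connected , acyclic) (s≤s (s≤s z≤n)) n = mk⇔ to from
  where
  open Walks E
  open Forest symmetric loopless acyclic
  open WithoutIsolatedVertices (connected⇒neighbour connected)

  to : LongestPathLength E n → PatternStableAt n × (∀ k → PatternStableAt k → n ≤ k)
  to ((x , xs , path , len) , bounded) =
    pathsBounded⇒patternStable n bounded ,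
    λ k stable → subst (_≤ k) len (patternStable⇒pathsBounded k stable x xs path)

  longest : ∀ n → PatternStableAt n → (∀ k → PatternStableAt k → n ≤ k) → HasPathOfLength n
  longest zero    stable _ = ⊥-elim (1+n≰n (patternStable⇒pathsBounded 0 stable zero _ (neighbour-path zero)))
  longest (suc k) _ minimal with patternStable-or-longPath k
  ... | inj₁ stable = ⊥-elim (1+n≰n (minimal k stable))
  ... | inj₂ path   = path

  from : PatternStableAt n × (∀ k → PatternStableAt k → n ≤ k) → LongestPathLength E n
  from (stable , minimal) = longest n stable minimal , patternStable⇒pathsBounded n stable
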